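{- Let $n$ be a positive integer and $y_n=\frac{n+\sqrt{n^2+4}}{2}=[n,n,n,\dots]$. Then the $q$-deformation $[y_n]_q$ satisfies $$q\,[y_n]_q^2+\big((1+q^n)(1-q)-q[n]_q\big)[y_n]_q=1,$$ and it is the unique formal power series satisfying this equation.
   Context: For $a\in\mathbb{Z}$ put $[a]_q=\frac{1-q^a}{1-q}$ and $[a]_{q^{ -1}}=q^{1-a}[a]_q$. For an irrational $x$ with regular continued fraction $x=[a_1,a_2,\dots]$ ($a_1\in\mathbb{Z}$, $a_i\ge1$ for $i\ge2$), its $q$-deformation is the formal series $$[x]_q=[a_1]_q+\cfrac{q^{a_1}}{[a_2]_{q^{ -1}}+\cfrac{q^{ -a_2}}{[a_3]_q+\cfrac{q^{a_3}}{[a_4]_{q^{ -1}}+\cfrac{q^{ -a_4}}{\ddots}}}},$$ defined as the limit of the finite truncations (whose coefficients stabilize). -}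

module Defs where

open import Data.Nat using (ℕ; zero; suc; _⊔_; _∸_; _<_; _≤_) renaming (_+_ to _+ℕ_)
open import Data.Integer using (ℤ; +_; -[1+_]; _+_; _*_; -_; _-_)
open import Data.List using (List; []; _∷_; replicate; _++_; map)
open import Data.Bool using (Bool; true; false; not)
open import Data.Product using (_×_; _,_; Σ)
open import Relation.Binary.PropositionalEquality using (_≡_; _≢_)

-- Polynomials over ℤ as coefficient lists (index i = coefficient of q^i)

Poly : Set
Poly = List ℤ

addP : Poly → Poly → Poly
addP []       r        = r
addP (x ∷ p)  []       = x ∷ p
addP (x ∷ p)  (y ∷ r)  = (x + y) ∷ addP p r

scaleP : ℤ → Poly → Poly
scaleP c p = map (c *_) p

mulP : Poly → Poly → Poly
mulP []      r = []
mulP (x ∷ p) r = addP (scaleP x r) (+ 0 ∷ mulP p r)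

shiftP : ℕ → Poly → Poly
shiftP k p = replicate k (+ 0) ++ p

coeffP : Poly → ℕ → ℤ
coeffP []      _       = + 0
coeffP (x ∷ p) zero    = x
coeffP (x ∷ p) (suc j) = coeffP p j

-- Laurent polynomials:  (s , p)  represents  q^{-s} · p(q)

LPoly : Set
LPoly = ℕ × Poly

lpAdd : LPoly → LPoly → LPoly
lpAdd (s , p) (t , r) = (s ⊔ t , addP (shiftP ((s ⊔ t) ∸ s) p) (shiftP ((s ⊔ t) ∸ t) r))

lpMul : LPoly → LPoly → LPoly
lpMul (s , p) (t , r) = (s +ℕ t , mulP p r)

lpOne : LPoly
lpOne = (0 , + 1 ∷ [])

mono : ℤ → LPoly
mono (+ k)     = (0 , shiftP k (+ 1 ∷ []))
mono -[1+ m ]  = (suc m , + 1 ∷ [])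

-- [a]_q = (1 - q^a)/(1 - q), a ∈ ℤ
--   a = k ≥ 0 :  1 + q + ... + q^{k-1}
--   a = -(m+1):  -(q^{-(m+1)} + ... + q^{-1})
qInt : ℤ → LPoly
qInt (+ k)    = (0 , replicate k (+ 1))
qInt -[1+ m ] = (suc m , replicate (suc m) (- (+ 1)))

-- [a]_{q^{-1}} = q^{1-a} [a]_q
qIntInv : ℤ → LPoly
qIntInv a = lpMul (mono (+ 1 - a)) (qInt a)

-- A fraction is a pair (numerator , denominator) of Laurent polynomials.
-- cfTail a b i m  is the value of the continued fraction starting at
-- index i (0-based; index 0 is a_1) with m further levels; the flag b
-- is true at indices that use [a]_q and q^{a}, false at those using
-- [a]_{q^{-1}} and q^{-a}.

leadTerm : Bool → ℤ → LPoly
leadTerm true  a = qInt a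
leadTerm false a = qIntInv a

numTerm : Bool → ℤ → LPoly
numTerm true  a = mono a
numTerm false a = mono (- a)

cfTail : (ℕ → ℤ) → Bool → ℕ → ℕ → LPoly × LPoly
cfTail a b i zero    = (leadTerm b (a i) , lpOne)
cfTail a b i (suc m) with cfTail a (not b) (suc i) m
... | (N , D) = (lpAdd (lpMul (leadTerm b (a i)) N) (lpMul (numTerm b (a i)) D) , N)
-- c + e / (N/D) = (c N + e D) / N

truncation : (ℕ → ℤ) → ℕ → LPoly × LPoly
truncation a m = cfTail a true 0 m

toPolyFrac : LPoly × LPoly → Poly × Poly
toPolyFrac ((t , r) , (s , p)) = (shiftP ((s ⊔ t) ∸ t) r , shiftP ((s ⊔ t) ∸ s) p)

PS : Set
PS = ℕ → ℤ

sumTo : (ℕ → ℤ) → ℕ → ℤ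
sumTo f zero    = f zero
sumTo f (suc j) = sumTo f j + f (suc j)

psAdd : PS → PS → PS
psAdd f g j = f j + g j

psMul : PS → PS → PS
psMul f g j = sumTo (λ i → f i * g (j ∸ i)) j

fromPoly : Poly → PS
fromPoly = coeffP

qPS : PS
qPS = fromPoly (+ 0 ∷ + 1 ∷ [])

-- With v the q-adic valuation of P, the Laurent expansion of R/P agrees
-- with the power series S in all degrees ≤ k (including negative degrees,
-- where S is 0) iff  P·S - R ≡ 0  mod q^{k+1+v}.

AgreesUpTo : PS → ℕ → Poly × Poly → Set
AgreesUpTo S k (R , P) =
  Σ ℕ λ v → (coeffP P v ≢ + 0)
          × (∀ j → j < v → coeffP P j ≡ + 0)
          × (∀ j → j ≤ k +ℕ v → psMul (fromPoly P) S j ≡ coeffP R j)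

-- S = [x]_q for x = [a_1, a_2, ...]: the coefficients of the expansions of
-- the finite truncations stabilise to those of S.
IsQDeformation : (ℕ → ℤ) → PS → Set
IsQDeformation a S =
  ∀ k → Σ ℕ λ N → ∀ m → N ≤ m → AgreesUpTo S k (toPolyFrac (truncation a m))

qIntPoly : ℕ → Poly
qIntPoly n = replicate n (+ 1)

coeffPoly : ℕ → Poly
coeffPoly n =
  addP (mulP (addP (+ 1 ∷ []) (shiftP n (+ 1 ∷ []))) (+ 1 ∷ - (+ 1) ∷ []))
       (scaleP (- (+ 1)) (shiftP 1 (qIntPoly n)))

QuadEq : ℕ → PS → Set
QuadEq n S =
  ∀ j → psAdd (psMul qPS (psMul S S)) (psMul (fromPoly (coeffPoly n)) S) j
        ≡ fromPoly (+ 1 ∷ []) j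

-- ℤ[[q]] is a commutative ring in which congruence modulo q^m means agreement of
-- the first m coefficients.  Writing c = 1 + q c′, the equation q T² + c T = 1 reads
-- T = 1 − q (T² + c′ T), whose right-hand side is a q-adic contraction, so it has
-- exactly one solution Y.  Two levels of the continued fraction [n, n, …] act on its
-- value by x ↦ [n]_q + q²ⁿ x / (1 + q [n]_q x), and since (1 − q) [n]_q = 1 − qⁿ the
-- quadratic equation says that Y is a fixed point of this map.  So if the m-th
-- truncation is R_m / P_m, the error E_m = R_m − P_m Y satisfies
-- E_(m+2) (1 + q [n]_q Y) = q²ⁿ E_m; as 1 + q [n]_q Y is a unit, E_m ≡ 0 mod q^m.

module Submission where

open import Defs
open import Data.Nat as ℕ using (ℕ; zero; suc; z≤n; s≤s; _≤_; _<_; _∸_)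
import Data.Nat.Properties as ℕP
open import Data.Integer as ℤ using (ℤ; +_; _+_; _*_; -_)
import Data.Integer.Properties as ℤP
open import Data.List using ([]; _∷_)
open import Data.Product using (Σ; _×_; _,_)
open import Data.Sum using (inj₁; inj₂)
open import Data.Maybe using (Maybe; just; nothing)
open import Data.Bool using (true; false)
open import Relation.Binary.PropositionalEquality
open import Relation.Nullary using (yes; no)
open import Level using (0ℓ)
open import Algebra.Bundles using (CommutativeRing)
open import Algebra.Structures using (IsCommutativeRing)
import Algebra.Construct.Pointwise as Pointwise
import Algebra.Properties.CommutativeSemigroup as CommSemigroupProps
import Algebra.Solver.Ring.AlmostCommutativeRing as ACR
import Relation.Binary.Reasoning.Setoid

open CommSemigroupProps ℤP.+-commutativeSemigroup using (interchange; x∙yz≈y∙xz)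

-- Formal power series

infixl 6 _+ˢ_
infixl 7 _*ˢ_
infix 8 -ˢ_
infixl 6 _-ˢ_
infix 4 _≡_mod-q^_

tailˢ : PS → PS
tailˢ f i = f (suc i)

_+ˢ_ : PS → PS → PS
_+ˢ_ = psAdd

-ˢ_ : PS → PS
(-ˢ f) j = - f j

_-ˢ_ : PS → PS → PS
f -ˢ g = f +ˢ -ˢ g

0ˢ : PS
0ˢ _ = + 0

constˢ : ℤ → PS
constˢ c = fromPoly (c ∷ [])

1ˢ : PS
1ˢ = constˢ (+ 1)

_*ˢ_ : PS → PS → PS
(f *ˢ g) zero    = f 0 * g 0
(f *ˢ g) (suc j) = f 0 * g (suc j) + (tailˢ f *ˢ g) j

_≡_mod-q^_ : PS → PS → ℕ → Set
f ≡ g mod-q^ m = ∀ i → i < m → f i ≡ g i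

*ˢ-coeff-cong : ∀ j {f f′ g g′} → f ≡ f′ mod-q^ suc j → g ≡ g′ mod-q^ suc j →
              (f *ˢ g) j ≡ (f′ *ˢ g′) j
*ˢ-coeff-cong zero    f≡ g≡ = cong₂ _*_ (f≡ 0 (s≤s z≤n)) (g≡ 0 (s≤s z≤n))
*ˢ-coeff-cong (suc j) f≡ g≡ =
  cong₂ _+_ (cong₂ _*_ (f≡ 0 (s≤s z≤n)) (g≡ (suc j) ℕP.≤-refl))
            (*ˢ-coeff-cong j (λ i i<j → f≡ (suc i) (s≤s i<j))
                             (λ i i<j → g≡ i (ℕP.m≤n⇒m≤1+n i<j)))

*ˢ-cong : ∀ {f f′ g g′} → f ≗ f′ → g ≗ g′ → f *ˢ g ≗ f′ *ˢ g′
*ˢ-cong f≗ g≗ j = *ˢ-coeff-cong j (λ i _ → f≗ i) (λ i _ → g≗ i)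

*ˢ-zeroˡ : ∀ f → 0ˢ *ˢ f ≗ 0ˢ
*ˢ-zeroˡ f zero    = refl
*ˢ-zeroˡ f (suc j) = trans (ℤP.+-identityˡ _) (*ˢ-zeroˡ f j)

*ˢ-identityˡ : ∀ f → 1ˢ *ˢ f ≗ f
*ˢ-identityˡ f zero    = ℤP.*-identityˡ (f 0)
*ˢ-identityˡ f (suc j) = begin
  + 1 * f (suc j) + (0ˢ *ˢ f) j ≡⟨ cong₂ _+_ (ℤP.*-identityˡ (f (suc j))) (*ˢ-zeroˡ f j) ⟩
  f (suc j) + + 0               ≡⟨ ℤP.+-identityʳ (f (suc j)) ⟩
  f (suc j)                     ∎
  where open ≡-Reasoning

*ˢ-distribʳ : ∀ h f g → (f +ˢ g) *ˢ h ≗ f *ˢ h +ˢ g *ˢ h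
*ˢ-distribʳ h f g zero    = ℤP.*-distribʳ-+ (h 0) (f 0) (g 0)
*ˢ-distribʳ h f g (suc j) = begin
  (f 0 + g 0) * h (suc j) + (tailˢ (f +ˢ g) *ˢ h) j
    ≡⟨ cong₂ _+_ (ℤP.*-distribʳ-+ (h (suc j)) (f 0) (g 0))
                 (*ˢ-distribʳ h (tailˢ f) (tailˢ g) j) ⟩
  (f 0 * h (suc j) + g 0 * h (suc j)) + ((tailˢ f *ˢ h) j + (tailˢ g *ˢ h) j)
    ≡⟨ interchange (f 0 * h (suc j)) (g 0 * h (suc j)) _ _ ⟩
  (f *ˢ h +ˢ g *ˢ h) (suc j) ∎
  where open ≡-Reasoning

*ˢ-comm : ∀ f g → f *ˢ g ≗ g *ˢ f
*ˢ-comm f g zero = ℤP.*-comm (f 0) (g 0)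
*ˢ-comm f g (suc zero) = begin
  f 0 * g 1 + (tailˢ f *ˢ g) 0 ≡⟨ cong (_+_ (f 0 * g 1)) (*ˢ-comm (tailˢ f) g 0) ⟩
  f 0 * g 1 + g 0 * f 1        ≡⟨ ℤP.+-comm (f 0 * g 1) (g 0 * f 1) ⟩
  g 0 * f 1 + f 0 * g 1        ≡⟨ cong (_+_ (g 0 * f 1)) (ℤP.*-comm (f 0) (g 1)) ⟩
  (g *ˢ f) 1                   ∎
  where open ≡-Reasoning
*ˢ-comm f g (suc (suc i)) = begin
  f 0 * g (suc (suc i)) + (tailˢ f *ˢ g) (suc i)
    ≡⟨ cong (_+_ (f 0 * g (suc (suc i)))) (*ˢ-comm (tailˢ f) g (suc i)) ⟩
  f 0 * g (suc (suc i)) + (g 0 * f (suc (suc i)) + (tailˢ g *ˢ tailˢ f) i)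
    ≡⟨ cong (λ x → f 0 * g (suc (suc i)) + (g 0 * f (suc (suc i)) + x))
            (*ˢ-comm (tailˢ g) (tailˢ f) i) ⟩
  f 0 * g (suc (suc i)) + (g 0 * f (suc (suc i)) + (tailˢ f *ˢ tailˢ g) i)
    ≡⟨ x∙yz≈y∙xz (f 0 * g (suc (suc i))) (g 0 * f (suc (suc i))) _ ⟩
  g 0 * f (suc (suc i)) + (f *ˢ tailˢ g) (suc i)
    ≡⟨ cong (_+_ (g 0 * f (suc (suc i)))) (*ˢ-comm f (tailˢ g) (suc i)) ⟩
  (g *ˢ f) (suc (suc i)) ∎
  where open ≡-Reasoning

*ˢ-scaleˡ : ∀ c f g → (λ i → c * f i) *ˢ g ≗ (λ i → c * (f *ˢ g) i)
*ˢ-scaleˡ c f g zero    = ℤP.*-assoc c (f 0) (g 0)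
*ˢ-scaleˡ c f g (suc j) = begin
  c * f 0 * g (suc j) + ((λ i → c * tailˢ f i) *ˢ g) j
    ≡⟨ cong₂ _+_ (ℤP.*-assoc c (f 0) (g (suc j))) (*ˢ-scaleˡ c (tailˢ f) g j) ⟩
  c * (f 0 * g (suc j)) + c * (tailˢ f *ˢ g) j
    ≡⟨ ℤP.*-distribˡ-+ c (f 0 * g (suc j)) _ ⟨
  c * (f *ˢ g) (suc j) ∎
  where open ≡-Reasoning

*ˢ-assoc : ∀ f g h → (f *ˢ g) *ˢ h ≗ f *ˢ (g *ˢ h)
*ˢ-assoc f g h zero    = ℤP.*-assoc (f 0) (g 0) (h 0)
*ˢ-assoc f g h (suc j) = begin
  f 0 * g 0 * h (suc j) + (tailˢ (f *ˢ g) *ˢ h) j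
    ≡⟨ cong (_+_ (f 0 * g 0 * h (suc j))) tail-product ⟩
  f 0 * g 0 * h (suc j) + (f 0 * (tailˢ g *ˢ h) j + (tailˢ f *ˢ (g *ˢ h)) j)
    ≡⟨ ℤP.+-assoc (f 0 * g 0 * h (suc j)) _ _ ⟨
  f 0 * g 0 * h (suc j) + f 0 * (tailˢ g *ˢ h) j + (tailˢ f *ˢ (g *ˢ h)) j
    ≡⟨ cong (_+ (tailˢ f *ˢ (g *ˢ h)) j) factor-f₀ ⟩
  (f *ˢ (g *ˢ h)) (suc j) ∎
  where
  open ≡-Reasoning
  tail-product : (tailˢ (f *ˢ g) *ˢ h) j ≡ f 0 * (tailˢ g *ˢ h) j + (tailˢ f *ˢ (g *ˢ h)) j
  tail-product = trans (*ˢ-distribʳ h (λ i → f 0 * g (suc i)) (tailˢ f *ˢ g) j)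
                       (cong₂ _+_ (*ˢ-scaleˡ (f 0) (tailˢ g) h j) (*ˢ-assoc (tailˢ f) g h j))
  factor-f₀ : f 0 * g 0 * h (suc j) + f 0 * (tailˢ g *ˢ h) j ≡ f 0 * (g *ˢ h) (suc j)
  factor-f₀ = trans (cong (_+ f 0 * (tailˢ g *ˢ h) j) (ℤP.*-assoc (f 0) (g 0) (h (suc j))))
                    (sym (ℤP.*-distribˡ-+ (f 0) (g 0 * h (suc j)) _))

PS-isCommutativeRing : IsCommutativeRing _≗_ _+ˢ_ _*ˢ_ -ˢ_ 0ˢ 1ˢ
PS-isCommutativeRing = record
  { isRing = record
    { +-isAbelianGroup = Pointwise.isAbelianGroup ℕ ℤP.+-0-isAbelianGroup
    ; *-cong           = *ˢ-cong
    ; *-assoc          = *ˢ-assoc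
    ; *-identity       = *ˢ-identityˡ , λ f j → trans (*ˢ-comm f 1ˢ j) (*ˢ-identityˡ f j)
    ; distrib          = distribˡ , *ˢ-distribʳ
    }
  ; *-comm = *ˢ-comm
  }
  where
  distribˡ : ∀ h f g → h *ˢ (f +ˢ g) ≗ h *ˢ f +ˢ h *ˢ g
  distribˡ h f g j = trans (*ˢ-comm h (f +ˢ g) j)
    (trans (*ˢ-distribʳ h f g j) (cong₂ _+_ (*ˢ-comm f h j) (*ˢ-comm g h j)))

PS-ring : CommutativeRing 0ℓ 0ℓ
PS-ring = record { isCommutativeRing = PS-isCommutativeRing }

constˢ-homomorphism :
  CommutativeRing.rawRing ℤP.+-*-commutativeRing
    ACR.-Raw-AlmostCommutative⟶ ACR.fromCommutativeRing PS-ring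
constˢ-homomorphism = record
  { ⟦_⟧    = constˢ
  ; +-homo = λ { a b zero → refl ; a b (suc j) → refl }
  ; *-homo = λ { a b zero → refl
               ; a b (suc j) → sym (cong₂ _+_ (ℤP.*-zeroʳ a) (*ˢ-zeroˡ (constˢ b) j)) }
  ; -‿homo = λ { a zero → refl ; a (suc j) → refl }
  ; 0-homo = λ { zero → refl ; (suc j) → refl }
  ; 1-homo = λ { zero → refl ; (suc j) → refl }
  }

constˢ-≟ : ∀ a b → Maybe (constˢ a ≗ constˢ b)
constˢ-≟ a b with a ℤ.≟ b
... | yes refl = just λ _ → refl
... | no _     = nothing

open import Algebra.Solver.Ring (CommutativeRing.rawRing ℤP.+-*-commutativeRing)
  (ACR.fromCommutativeRing PS-ring) constˢ-homomorphism constˢ-≟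
  using (solve; _:=_; _:+_; _:*_; _:-_; con)

module PS = CommutativeRing PS-ring
module ≗-Reasoning = Relation.Binary.Reasoning.Setoid PS.setoid

+ˢ-congˡ : ∀ h {f g} → f ≗ g → h +ˢ f ≗ h +ˢ g
+ˢ-congˡ h f≗g j = cong (_+_ (h j)) (f≗g j)

+ˢ-congʳ : ∀ h {f g} → f ≗ g → f +ˢ h ≗ g +ˢ h
+ˢ-congʳ h f≗g j = cong (_+ h j) (f≗g j)

-ˢ-cong : ∀ {f g} → f ≗ g → -ˢ f ≗ -ˢ g
-ˢ-cong f≗g j = cong -_ (f≗g j)

f≗g⇒f-g≗0 : ∀ {f g} → f ≗ g → f -ˢ g ≗ 0ˢ
f≗g⇒f-g≗0 f≗g j = ℤP.i≡j⇒i-j≡0 (f≗g j)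

f-g≗0⇒f≗g : ∀ {f g} → f -ˢ g ≗ 0ˢ → f ≗ g
f-g≗0⇒f≗g f-g≗0 j = ℤP.i-j≡0⇒i≡j _ _ (f-g≗0 j)

+ˢ-cong : ∀ {f f′ g g′} → f ≗ f′ → g ≗ g′ → f +ˢ g ≗ f′ +ˢ g′
+ˢ-cong f≗ g≗ j = cong₂ _+_ (f≗ j) (g≗ j)

*ˢ-congˡ : ∀ h {f g} → f ≗ g → h *ˢ f ≗ h *ˢ g
*ˢ-congˡ h f≗g = *ˢ-cong (λ _ → refl) f≗g

*ˢ-congʳ : ∀ h {f g} → f ≗ g → f *ˢ h ≗ g *ˢ h
*ˢ-congʳ h f≗g = *ˢ-cong f≗g (λ _ → refl)

qPS^_ : ℕ → PS
qPS^ zero  = 1ˢ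
qPS^ suc k = qPS *ˢ qPS^ k

qPS*-suc : ∀ f j → (qPS *ˢ f) (suc j) ≡ f j
qPS*-suc f j = trans (ℤP.+-identityˡ _) (*ˢ-identityˡ f j)

sumTo-head : ∀ F j → sumTo F (suc j) ≡ F 0 + sumTo (tailˢ F) j
sumTo-head F zero    = refl
sumTo-head F (suc j) = trans (cong (_+ F (suc (suc j))) (sumTo-head F j))
                             (ℤP.+-assoc (F 0) (sumTo (tailˢ F) j) (F (suc (suc j))))

psMul≗*ˢ : ∀ f g → psMul f g ≗ f *ˢ g
psMul≗*ˢ f g zero    = refl
psMul≗*ˢ f g (suc j) = trans (sumTo-head (λ i → f i * g (suc j ∸ i)) j)
                             (cong (_+_ (f 0 * g (suc j))) (psMul≗*ˢ (tailˢ f) g j))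

coeffP-addP : ∀ p r → coeffP (addP p r) ≗ coeffP p +ˢ coeffP r
coeffP-addP []      r       j       = sym (ℤP.+-identityˡ _)
coeffP-addP (x ∷ p) []      j       = sym (ℤP.+-identityʳ _)
coeffP-addP (x ∷ p) (y ∷ r) zero    = refl
coeffP-addP (x ∷ p) (y ∷ r) (suc j) = coeffP-addP p r j

coeffP-scaleP : ∀ c p j → coeffP (scaleP c p) j ≡ c * coeffP p j
coeffP-scaleP c []      j       = sym (ℤP.*-zeroʳ c)
coeffP-scaleP c (x ∷ p) zero    = refl
coeffP-scaleP c (x ∷ p) (suc j) = coeffP-scaleP c p j

coeffP-mulP : ∀ p r → coeffP (mulP p r) ≗ coeffP p *ˢ coeffP r
coeffP-mulP []      r j       = sym (*ˢ-zeroˡ (coeffP r) j)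
coeffP-mulP (x ∷ p) r zero    = trans (coeffP-addP (scaleP x r) (+ 0 ∷ mulP p r) 0)
                                      (trans (ℤP.+-identityʳ _) (coeffP-scaleP x r 0))
coeffP-mulP (x ∷ p) r (suc j) = trans (coeffP-addP (scaleP x r) (+ 0 ∷ mulP p r) (suc j))
                                      (cong₂ _+_ (coeffP-scaleP x r (suc j)) (coeffP-mulP p r j))

coeffP-cons-zero : ∀ p → coeffP (+ 0 ∷ p) ≗ qPS *ˢ coeffP p
coeffP-cons-zero p zero    = refl
coeffP-cons-zero p (suc j) = sym (qPS*-suc (coeffP p) j)

coeffP-shiftP : ∀ k p → coeffP (shiftP k p) ≗ qPS^ k *ˢ coeffP p
coeffP-shiftP zero    p j = sym (*ˢ-identityˡ (coeffP p) j)
coeffP-shiftP (suc k) p j = begin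
  coeffP (+ 0 ∷ shiftP k p) j       ≡⟨ coeffP-cons-zero (shiftP k p) j ⟩
  (qPS *ˢ coeffP (shiftP k p)) j    ≡⟨ *ˢ-congˡ qPS (coeffP-shiftP k p) j ⟩
  (qPS *ˢ (qPS^ k *ˢ coeffP p)) j   ≡⟨ *ˢ-assoc qPS (qPS^ k) (coeffP p) j ⟨
  (qPS^ suc k *ˢ coeffP p) j        ∎
  where open ≡-Reasoning

coeffP-monomial : ∀ d → coeffP (shiftP d (+ 1 ∷ [])) ≗ qPS^ d
coeffP-monomial d j = trans (coeffP-shiftP d (+ 1 ∷ []) j) (PS.*-identityʳ (qPS^ d) j)

coeffP-mulP-one : ∀ p → coeffP (mulP (+ 1 ∷ []) p) ≗ coeffP p
coeffP-mulP-one p j = trans (coeffP-mulP (+ 1 ∷ []) p j) (*ˢ-identityˡ (coeffP p) j)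

constant+q*tail : ∀ f → f ≗ constˢ (f 0) +ˢ qPS *ˢ tailˢ f
constant+q*tail f zero    = sym (ℤP.+-identityʳ (f 0))
constant+q*tail f (suc j) = sym (trans (ℤP.+-identityˡ _) (qPS*-suc (tailˢ f) j))

geometric-sum : ∀ m → (1ˢ -ˢ qPS) *ˢ coeffP (qIntPoly m) ≗ 1ˢ -ˢ qPS^ m
geometric-sum zero    j = trans (PS.zeroʳ (1ˢ -ˢ qPS) j) (sym (ℤP.+-inverseʳ (1ˢ j)))
geometric-sum (suc m) = begin
  (1ˢ -ˢ qPS) *ˢ coeffP (+ 1 ∷ qIntPoly m)
    ≈⟨ *ˢ-congˡ (1ˢ -ˢ qPS) (constant+q*tail (coeffP (+ 1 ∷ qIntPoly m))) ⟩
  (1ˢ -ˢ qPS) *ˢ (1ˢ +ˢ qPS *ˢ coeffP (qIntPoly m))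
    ≈⟨ solve 2 (λ q P → (con (+ 1) :- q) :* (con (+ 1) :+ q :* P)
                      := con (+ 1) :- q :+ q :* ((con (+ 1) :- q) :* P)) (λ _ → refl) qPS _ ⟩
  1ˢ -ˢ qPS +ˢ qPS *ˢ ((1ˢ -ˢ qPS) *ˢ coeffP (qIntPoly m))
    ≈⟨ +ˢ-congˡ (1ˢ -ˢ qPS) (*ˢ-congˡ qPS (geometric-sum m)) ⟩
  1ˢ -ˢ qPS +ˢ qPS *ˢ (1ˢ -ˢ qPS^ m)
    ≈⟨ solve 2 (λ q Q → con (+ 1) :- q :+ q :* (con (+ 1) :- Q) := con (+ 1) :- q :* Q)
               (λ _ → refl) qPS (qPS^ m) ⟩
  1ˢ -ˢ qPS^ suc m ∎
  where open ≗-Reasoning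

coeffP-coeffPoly : ∀ n →
  coeffP (coeffPoly n) ≗ (1ˢ +ˢ qPS^ n) *ˢ (1ˢ -ˢ qPS) -ˢ qPS *ˢ coeffP (qIntPoly n)
coeffP-coeffPoly n = begin
  coeffP (addP A (scaleP (- + 1) (+ 0 ∷ qIntPoly n)))
    ≈⟨ coeffP-addP A (scaleP (- + 1) (+ 0 ∷ qIntPoly n)) ⟩
  coeffP A +ˢ coeffP (scaleP (- + 1) (+ 0 ∷ qIntPoly n))
    ≈⟨ +ˢ-cong (coeffP-mulP B (+ 1 ∷ - + 1 ∷ [])) negated ⟩
  coeffP B *ˢ coeffP (+ 1 ∷ - + 1 ∷ []) -ˢ qPS *ˢ coeffP (qIntPoly n)
    ≈⟨ +ˢ-congʳ (-ˢ (qPS *ˢ coeffP (qIntPoly n))) (*ˢ-cong B≗ 1-q) ⟩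
  (1ˢ +ˢ qPS^ n) *ˢ (1ˢ -ˢ qPS) -ˢ qPS *ˢ coeffP (qIntPoly n) ∎
  where
  open ≗-Reasoning
  B = addP (+ 1 ∷ []) (shiftP n (+ 1 ∷ []))
  A = mulP B (+ 1 ∷ - + 1 ∷ [])
  B≗ : coeffP B ≗ 1ˢ +ˢ qPS^ n
  B≗ j = trans (coeffP-addP (+ 1 ∷ []) (shiftP n (+ 1 ∷ [])) j) (+ˢ-congˡ 1ˢ (coeffP-monomial n) j)
  1-q : coeffP (+ 1 ∷ - + 1 ∷ []) ≗ 1ˢ -ˢ qPS
  1-q zero          = refl
  1-q (suc zero)    = refl
  1-q (suc (suc j)) = refl
  negated : coeffP (scaleP (- + 1) (+ 0 ∷ qIntPoly n)) ≗ -ˢ (qPS *ˢ coeffP (qIntPoly n))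
  negated j = trans (coeffP-scaleP (- + 1) (+ 0 ∷ qIntPoly n) j)
    (trans (ℤP.-1*i≡-i (coeffP (+ 0 ∷ qIntPoly n) j)) (cong -_ (coeffP-cons-zero (qIntPoly n) j)))

-- Congruences modulo powers of q

mod-weaken : ∀ {m m′ f g} → m ≤ m′ → f ≡ g mod-q^ m′ → f ≡ g mod-q^ m
mod-weaken m≤m′ f≡g i i<m = f≡g i (ℕP.<-≤-trans i<m m≤m′)

*ˢ-mod : ∀ {m f f′ g g′} → f ≡ f′ mod-q^ m → g ≡ g′ mod-q^ m →
         f *ˢ g ≡ f′ *ˢ g′ mod-q^ m
*ˢ-mod f≡ g≡ i i<m = *ˢ-coeff-cong i (mod-weaken i<m f≡) (mod-weaken i<m g≡)

qPS*-mod : ∀ {m f g} → f ≡ g mod-q^ m → qPS *ˢ f ≡ qPS *ˢ g mod-q^ suc m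
qPS*-mod f≡g zero _ = refl
qPS*-mod {f = f} {g} f≡g (suc i) (s≤s i<m) =
  trans (qPS*-suc f i) (trans (f≡g i i<m) (sym (qPS*-suc g i)))

*ˢ-order : ∀ h {m f} → f ≡ 0ˢ mod-q^ m → h *ˢ f ≡ 0ˢ mod-q^ m
*ˢ-order h f≡0 i i<m = trans (*ˢ-mod {f = h} (λ _ _ → refl) f≡0 i i<m) (PS.zeroʳ h i)

qPS*-order : ∀ {m f} → f ≡ 0ˢ mod-q^ m → qPS *ˢ f ≡ 0ˢ mod-q^ suc m
qPS*-order f≡0 zero _ = refl
qPS*-order {f = f} f≡0 (suc i) (s≤s i<m) = trans (qPS*-suc f i) (f≡0 i i<m)

*ˢ-coeff-at-order : ∀ {m f} g → f ≡ 0ˢ mod-q^ m → (f *ˢ g) m ≡ f m * g 0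
*ˢ-coeff-at-order {zero}      g f≡0 = refl
*ˢ-coeff-at-order {suc m} {f} g f≡0 = begin
  f 0 * g (suc m) + (tailˢ f *ˢ g) m
    ≡⟨ cong₂ _+_ (cong (_* g (suc m)) (f≡0 0 (s≤s z≤n)))
                 (*ˢ-coeff-at-order g (λ i i<m → f≡0 (suc i) (s≤s i<m))) ⟩
  + 0 * g (suc m) + f (suc m) * g 0
    ≡⟨ ℤP.+-identityˡ _ ⟩
  f (suc m) * g 0 ∎
  where open ≡-Reasoning

mod-extend : ∀ {m f g} → f ≡ g mod-q^ m → f m ≡ g m → f ≡ g mod-q^ suc m
mod-extend f≡g fₘ≡gₘ i i<1+m with ℕP.m<1+n⇒m<n∨m≡n i<1+m
... | inj₁ i<m  = f≡g i i<m
... | inj₂ refl = fₘ≡gₘ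

mod-cancel-unit : ∀ {m f} w → w 0 ≡ + 1 → f *ˢ w ≡ 0ˢ mod-q^ m → f ≡ 0ˢ mod-q^ m
mod-cancel-unit {zero}      w w₀ fw≡0 = λ _ ()
mod-cancel-unit {suc m} {f} w w₀ fw≡0 = mod-extend f≡0 (begin
  f m             ≡⟨ ℤP.*-identityʳ (f m) ⟨
  f m * + 1       ≡⟨ cong (f m *_) w₀ ⟨
  f m * w 0       ≡⟨ *ˢ-coeff-at-order w f≡0 ⟨
  (f *ˢ w) m      ≡⟨ fw≡0 m ℕP.≤-refl ⟩
  + 0             ∎)
  where
  open ≡-Reasoning
  f≡0 : f ≡ 0ˢ mod-q^ m
  f≡0 = mod-cancel-unit w w₀ (mod-weaken (ℕP.n≤1+n m) fw≡0)

-- Contractions and the quadratic equation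

Contractive : (PS → PS) → Set
Contractive Φ = ∀ {m f g} → f ≡ g mod-q^ m → Φ f ≡ Φ g mod-q^ suc m

module _ {Φ : PS → PS} (contractive : Contractive Φ) where

  private
    iterate : ℕ → PS
    iterate zero    = 0ˢ
    iterate (suc m) = Φ (iterate m)

    iterate-stable : ∀ m → iterate m ≡ iterate (suc m) mod-q^ m
    iterate-stable zero    = λ _ ()
    iterate-stable (suc m) = contractive (iterate-stable m)

  fixedPoint : PS
  fixedPoint j = iterate (suc j) j

  private
    fixedPoint-approx : ∀ m → fixedPoint ≡ iterate m mod-q^ m
    fixedPoint-approx zero    = λ _ ()
    fixedPoint-approx (suc m) = mod-extend
      (λ i i<m → trans (fixedPoint-approx m i i<m) (iterate-stable m i i<m)) refl

  fixedPoint-isFixed : fixedPoint ≗ Φ fixedPoint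
  fixedPoint-isFixed j = sym (contractive (fixedPoint-approx j) j ℕP.≤-refl)

  fixedPoint-unique : ∀ {T} → T ≗ Φ T → T ≗ fixedPoint
  fixedPoint-unique {T} T-fixed j = T≡fixedPoint (suc j) j ℕP.≤-refl
    where
    T≡fixedPoint : ∀ m → T ≡ fixedPoint mod-q^ m
    T≡fixedPoint zero    = λ _ ()
    T≡fixedPoint (suc m) i i<1+m = begin
      T i               ≡⟨ T-fixed i ⟩
      Φ T i             ≡⟨ contractive (T≡fixedPoint m) i i<1+m ⟩
      Φ fixedPoint i    ≡⟨ fixedPoint-isFixed i ⟨
      fixedPoint i      ∎
      where open ≡-Reasoning

module QuadraticEquation (c : PS) (c₀ : c 0 ≡ + 1) where

  quadratic : PS → PS
  quadratic T = qPS *ˢ (T *ˢ T) +ˢ c *ˢ T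

  quadratic≗psMul : ∀ T → quadratic T ≗ psAdd (psMul qPS (psMul T T)) (psMul c T)
  quadratic≗psMul T j = sym (cong₂ _+_
    (trans (psMul≗*ˢ qPS (psMul T T) j) (*ˢ-congˡ qPS (psMul≗*ˢ T T) j)) (psMul≗*ˢ c T j))

  private
    Φ : PS → PS
    Φ T = 1ˢ -ˢ qPS *ˢ (T *ˢ T +ˢ tailˢ c *ˢ T)

    Φ-contractive : Contractive Φ
    Φ-contractive f≡g i i<1+m =
      cong (λ x → 1ˢ i ℤ.- x) (qPS*-mod (λ i′ i′<m →
        cong₂ _+_ (*ˢ-mod f≡g f≡g i′ i′<m)
                  (*ˢ-mod {f = tailˢ c} (λ _ _ → refl) f≡g i′ i′<m)) i i<1+m)

    c≗1+q*tail : c ≗ 1ˢ +ˢ qPS *ˢ tailˢ c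
    c≗1+q*tail zero    = trans (constant+q*tail c 0) (cong (_+ + 0) c₀)
    c≗1+q*tail (suc j) = constant+q*tail c (suc j)

    quadratic-residual : ∀ T → quadratic T -ˢ 1ˢ ≗ T -ˢ Φ T
    quadratic-residual T = begin
      qPS *ˢ (T *ˢ T) +ˢ c *ˢ T -ˢ 1ˢ
        ≈⟨ +ˢ-congʳ (-ˢ 1ˢ) (+ˢ-congˡ (qPS *ˢ (T *ˢ T)) (*ˢ-congʳ T c≗1+q*tail)) ⟩
      qPS *ˢ (T *ˢ T) +ˢ (1ˢ +ˢ qPS *ˢ tailˢ c) *ˢ T -ˢ 1ˢ
        ≈⟨ solve 3 (λ q c′ T → q :* (T :* T) :+ (con (+ 1) :+ q :* c′) :* T :- con (+ 1)
                            := T :- (con (+ 1) :- q :* (T :* T :+ c′ :* T)))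
                   (λ _ → refl) qPS (tailˢ c) T ⟩
      T -ˢ Φ T ∎
      where open ≗-Reasoning

  solution : PS
  solution = fixedPoint Φ-contractive

  solution-solves : quadratic solution ≗ 1ˢ
  solution-solves = f-g≗0⇒f≗g λ j →
    trans (quadratic-residual solution j) (f≗g⇒f-g≗0 (fixedPoint-isFixed Φ-contractive) j)

  solution-unique : ∀ T → quadratic T ≗ 1ˢ → T ≗ solution
  solution-unique T T-solves = fixedPoint-unique Φ-contractive (f-g≗0⇒f≗g λ j →
    trans (sym (quadratic-residual T j)) (f≗g⇒f-g≗0 T-solves j))

-- Truncations of the continued fraction [n, n, n, …]

lpAdd-shiftʳ : ∀ d t p r → lpAdd (d ℕ.+ t , p) (t , r) ≡ (d ℕ.+ t , addP p (shiftP d r))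
lpAdd-shiftʳ d t p r
  rewrite ℕP.m≥n⇒m⊔n≡m (ℕP.m≤n+m t d) | ℕP.n∸n≡0 (d ℕ.+ t) | ℕP.m+n∸n≡m d t = refl

lpAdd-shiftˡ : ∀ d t p r → lpAdd (t , p) (d ℕ.+ t , r) ≡ (d ℕ.+ t , addP (shiftP d p) r)
lpAdd-shiftˡ d t p r
  rewrite ℕP.m≤n⇒m⊔n≡n (ℕP.m≤n+m t d) | ℕP.n∸n≡0 (d ℕ.+ t) | ℕP.m+n∸n≡m d t = refl

qIntInv-suc : ∀ k → qIntInv (+ suc k) ≡ (k , mulP (+ 1 ∷ []) (qIntPoly (suc k)))
qIntInv-suc zero    = refl
qIntInv-suc (suc k) = cong (_, mulP (+ 1 ∷ []) (qIntPoly (suc (suc k)))) (ℕP.+-identityʳ (suc k))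

-- cfTail a b i (suc m) reduces to
-- cfStep (leadTerm b (a i)) (numTerm b (a i)) (cfTail a (not b) (suc i) m).
cfStep : LPoly → LPoly → LPoly × LPoly → LPoly × LPoly
cfStep L E (N , D) = (lpAdd (lpMul L N) (lpMul E D) , N)

-- The fraction (q⁻ˢ r) / (q⁻ᵗ p) equals q⁻ᵉ R / P, with s = e + t.
data Represents (e : ℕ) : LPoly × LPoly → PS → PS → Set where
  represents : ∀ {s t r p R P} → s ≡ e ℕ.+ t → coeffP r ≗ R → coeffP p ≗ P →
               Represents e ((s , r) , (t , p)) R P

agreesUpTo-represents : ∀ {x R P S j} → Represents 0 x R P → P 0 ≡ + 1 →
                        P *ˢ S ≡ R mod-q^ suc j → AgreesUpTo S j (toPolyFrac x)
agreesUpTo-represents {S = S} {j} (represents {t = t} {r} {p} {R} {P} refl r≗R p≗P) P₀≡1 PS≡R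
  rewrite ℕP.⊔-idem t | ℕP.n∸n≡0 t = 0 , p₀≢0 , (λ _ ()) , agree
  where
  p₀≢0 : coeffP p 0 ≢ + 0
  p₀≢0 p₀≡0 with trans (sym P₀≡1) (trans (sym (p≗P 0)) p₀≡0)
  ... | ()
  agree : ∀ i → i ≤ j ℕ.+ 0 → psMul (fromPoly p) S i ≡ coeffP r i
  agree i i≤j = begin
    psMul (coeffP p) S i  ≡⟨ psMul≗*ˢ (coeffP p) S i ⟩
    (coeffP p *ˢ S) i     ≡⟨ *ˢ-congʳ S p≗P i ⟩
    (P *ˢ S) i            ≡⟨ PS≡R i (s≤s (subst (i ≤_) (ℕP.+-identityʳ j) i≤j)) ⟩
    R i                   ≡⟨ r≗R i ⟨
    coeffP r i            ∎
    where open ≡-Reasoning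

module PeriodicContinuedFraction (k : ℕ) where

  n : ℕ
  n = suc k

  [n] : PS
  [n] = coeffP (qIntPoly n)

  -- Truncated after m further levels, the continued fraction has value numᵗ m / denᵗ m
  -- from a level using [n]_q, and q^(-gap m) numᶠ m / denᶠ m from a level using
  -- [n]_(q⁻¹) = q⁻ᵏ [n]_q.
  gap : ℕ → ℕ
  gap zero    = k
  gap (suc _) = n

  mutual
    numᵗ denᵗ numᶠ denᶠ : ℕ → PS
    numᵗ zero    = [n]
    numᵗ (suc m) = [n] *ˢ numᶠ m +ˢ qPS^ gap m *ˢ (qPS^ n *ˢ denᶠ m)
    denᵗ zero    = 1ˢ
    denᵗ (suc m) = numᶠ m
    numᶠ zero    = [n]
    numᶠ (suc m) = qPS *ˢ ([n] *ˢ numᵗ m) +ˢ denᵗ m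
    denᶠ zero    = 1ˢ
    denᶠ (suc m) = numᵗ m

  represents-stepᵗ : ∀ {g x R P} → Represents g x R P →
    Represents 0 (cfStep (qInt (+ n)) (mono (+ n)) x) ([n] *ˢ R +ˢ qPS^ g *ˢ (qPS^ n *ˢ P)) R
  represents-stepᵗ {g} (represents {t = t} {r} {p} {R} {P} refl r≗R p≗P) =
    subst (λ N → Represents 0 (N , (g ℕ.+ t , r)) _ _) (sym (lpAdd-shiftʳ g t _ _))
          (represents refl numerator≗ r≗R)
    where
    open ≗-Reasoning
    M = mulP (shiftP n (+ 1 ∷ [])) p
    numerator≗ : coeffP (addP (mulP (qIntPoly n) r) (shiftP g M)) ≗ [n] *ˢ R +ˢ qPS^ g *ˢ (qPS^ n *ˢ P)
    numerator≗ = begin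
      coeffP (addP (mulP (qIntPoly n) r) (shiftP g M))
        ≈⟨ coeffP-addP (mulP (qIntPoly n) r) (shiftP g M) ⟩
      coeffP (mulP (qIntPoly n) r) +ˢ coeffP (shiftP g M)
        ≈⟨ +ˢ-cong (coeffP-mulP (qIntPoly n) r) (coeffP-shiftP g M) ⟩
      [n] *ˢ coeffP r +ˢ qPS^ g *ˢ coeffP M
        ≈⟨ +ˢ-cong (*ˢ-congˡ [n] r≗R) (*ˢ-congˡ (qPS^ g) (coeffP-mulP (shiftP n (+ 1 ∷ [])) p)) ⟩
      [n] *ˢ R +ˢ qPS^ g *ˢ (coeffP (shiftP n (+ 1 ∷ [])) *ˢ coeffP p)
        ≈⟨ +ˢ-congˡ ([n] *ˢ R) (*ˢ-congˡ (qPS^ g) (*ˢ-cong (coeffP-monomial n) p≗P)) ⟩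
      [n] *ˢ R +ˢ qPS^ g *ˢ (qPS^ n *ˢ P) ∎

  represents-stepᶠ : ∀ {x R P} → Represents 0 x R P →
    Represents n (cfStep (k , mulP (+ 1 ∷ []) (qIntPoly n)) (mono (- + n)) x) (qPS *ˢ ([n] *ˢ R) +ˢ P) R
  represents-stepᶠ (represents {t = t} {r} {p} {R} {P} refl r≗R p≗P) =
    subst (λ N → Represents n (N , (t , r)) _ _) (sym (lpAdd-shiftˡ 1 (k ℕ.+ t) _ _))
          (represents refl numerator≗ r≗R)
    where
    open ≗-Reasoning
    L = mulP (+ 1 ∷ []) (qIntPoly n)
    numerator≗ : coeffP (addP (+ 0 ∷ mulP L r) (mulP (+ 1 ∷ []) p)) ≗ qPS *ˢ ([n] *ˢ R) +ˢ P
    numerator≗ = begin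
      coeffP (addP (+ 0 ∷ mulP L r) (mulP (+ 1 ∷ []) p))
        ≈⟨ coeffP-addP (+ 0 ∷ mulP L r) (mulP (+ 1 ∷ []) p) ⟩
      coeffP (+ 0 ∷ mulP L r) +ˢ coeffP (mulP (+ 1 ∷ []) p)
        ≈⟨ +ˢ-cong (coeffP-cons-zero (mulP L r)) (coeffP-mulP-one p) ⟩
      qPS *ˢ coeffP (mulP L r) +ˢ coeffP p
        ≈⟨ +ˢ-cong (*ˢ-congˡ qPS (coeffP-mulP L r)) p≗P ⟩
      qPS *ˢ (coeffP L *ˢ coeffP r) +ˢ P
        ≈⟨ +ˢ-congʳ P (*ˢ-congˡ qPS (*ˢ-cong (coeffP-mulP-one (qIntPoly n)) r≗R)) ⟩
      qPS *ˢ ([n] *ˢ R) +ˢ P ∎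

  mutual
    cfTailᵗ-represents : ∀ i m → Represents 0 (cfTail (λ _ → + n) true i m) (numᵗ m) (denᵗ m)
    cfTailᵗ-represents i zero    = represents refl (λ _ → refl) (λ _ → refl)
    cfTailᵗ-represents i (suc m) = represents-stepᵗ (cfTailᶠ-represents (suc i) m)

    cfTailᶠ-represents : ∀ i m →
      Represents (gap m) (cfTail (λ _ → + n) false i m) (numᶠ m) (denᶠ m)
    cfTailᶠ-represents i zero    = subst (λ L → Represents k (L , lpOne) [n] 1ˢ) (sym (qIntInv-suc k))
      (represents (sym (ℕP.+-identityʳ k)) (coeffP-mulP-one (qIntPoly n)) (λ _ → refl))
    cfTailᶠ-represents i (suc m) =
      subst (λ L → Represents n (cfStep L (mono (- + n)) (cfTail (λ _ → + n) true (suc i) m))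
                                   (numᶠ (suc m)) (denᶠ (suc m)))
            (sym (qIntInv-suc k)) (represents-stepᶠ (cfTailᵗ-represents (suc i) m))

  mutual
    denᵗ-constant : ∀ m → denᵗ m 0 ≡ + 1
    denᵗ-constant zero    = refl
    denᵗ-constant (suc m) = numᶠ-constant m

    numᶠ-constant : ∀ m → numᶠ m 0 ≡ + 1
    numᶠ-constant zero    = refl
    numᶠ-constant (suc m) = trans (ℤP.+-identityˡ (denᵗ m 0)) (denᵗ-constant m)

-- Convergence of the truncations

module Convergence (k : ℕ) where

  open PeriodicContinuedFraction k public
  open QuadraticEquation (coeffP (coeffPoly n)) refl public

  Y W : PS
  Y = solution
  W = 1ˢ +ˢ qPS *ˢ ([n] *ˢ Y)

  Y-fixed : Y *ˢ W ≗ [n] *ˢ W +ˢ qPS^ n *ˢ (qPS^ n *ˢ Y)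
  Y-fixed = f-g≗0⇒f≗g (begin
    Y *ˢ W -ˢ ([n] *ˢ W +ˢ qPS^ n *ˢ (qPS^ n *ˢ Y))
      ≈⟨ solve 4 (λ q Q N Y →
             Y :* (con (+ 1) :+ q :* (N :* Y)) :- (N :* (con (+ 1) :+ q :* (N :* Y)) :+ Q :* (Q :* Y))
           := N :* (q :* (Y :* Y) :+ ((con (+ 1) :+ Q) :* (con (+ 1) :- q) :- q :* N) :* Y :- con (+ 1))
              :- (con (+ 1) :+ Q) :* Y :* ((con (+ 1) :- q) :* N :- (con (+ 1) :- Q)))
           (λ _ → refl) qPS (qPS^ n) [n] Y ⟩
    [n] *ˢ (quadratic′ -ˢ 1ˢ) -ˢ (1ˢ +ˢ qPS^ n) *ˢ Y *ˢ ((1ˢ -ˢ qPS) *ˢ [n] -ˢ (1ˢ -ˢ qPS^ n))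
      ≈⟨ +ˢ-cong (*ˢ-congˡ [n] (f≗g⇒f-g≗0 quadratic′≗1))
                 (-ˢ-cong (*ˢ-congˡ ((1ˢ +ˢ qPS^ n) *ˢ Y) (f≗g⇒f-g≗0 (geometric-sum n)))) ⟩
    [n] *ˢ 0ˢ -ˢ (1ˢ +ˢ qPS^ n) *ˢ Y *ˢ 0ˢ
      ≈⟨ +ˢ-cong (PS.zeroʳ [n]) (-ˢ-cong (PS.zeroʳ ((1ˢ +ˢ qPS^ n) *ˢ Y))) ⟩
    0ˢ ∎)
    where
    open ≗-Reasoning
    quadratic′ = qPS *ˢ (Y *ˢ Y) +ˢ ((1ˢ +ˢ qPS^ n) *ˢ (1ˢ -ˢ qPS) -ˢ qPS *ˢ [n]) *ˢ Y
    quadratic′≗1 : quadratic′ ≗ 1ˢ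
    quadratic′≗1 j = trans (sym (+ˢ-congˡ (qPS *ˢ (Y *ˢ Y)) (*ˢ-congʳ Y (coeffP-coeffPoly n)) j))
                           (solution-solves j)

  error : ℕ → PS
  error m = numᵗ m -ˢ denᵗ m *ˢ Y

  error-one : error 1 *ˢ W ≗ qPS *ˢ (qPS^ k *ˢ qPS^ k)
  error-one = begin
    error 1 *ˢ W
      ≈⟨ solve 4 (λ r p Y W → (r :- p :* Y) :* W := r :* W :- p :* (Y :* W))
                 (λ _ → refl) (numᵗ 1) (denᵗ 1) Y W ⟩
    numᵗ 1 *ˢ W -ˢ [n] *ˢ (Y *ˢ W)
      ≈⟨ +ˢ-congˡ (numᵗ 1 *ˢ W) (-ˢ-cong (*ˢ-congˡ [n] Y-fixed)) ⟩
    numᵗ 1 *ˢ W -ˢ [n] *ˢ ([n] *ˢ W +ˢ qPS^ n *ˢ (qPS^ n *ˢ Y))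
      ≈⟨ solve 4 (λ q X N Y →
             (N :* N :+ X :* ((q :* X) :* con (+ 1))) :* (con (+ 1) :+ q :* (N :* Y))
             :- N :* (N :* (con (+ 1) :+ q :* (N :* Y)) :+ (q :* X) :* ((q :* X) :* Y))
           := q :* (X :* X))
           (λ _ → refl) qPS (qPS^ k) [n] Y ⟩
    qPS *ˢ (qPS^ k *ˢ qPS^ k) ∎
    where open ≗-Reasoning

  error-step : ∀ m → error (suc (suc m)) *ˢ W ≗ qPS *ˢ (qPS *ˢ (qPS^ k *ˢ qPS^ k *ˢ error m))
  error-step m = begin
    error (suc (suc m)) *ˢ W
      ≈⟨ solve 4 (λ r p Y W → (r :- p :* Y) :* W := r :* W :- p :* (Y :* W))
                 (λ _ → refl) (numᵗ (suc (suc m))) (denᵗ (suc (suc m))) Y W ⟩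
    numᵗ (suc (suc m)) *ˢ W -ˢ denᵗ (suc (suc m)) *ˢ (Y *ˢ W)
      ≈⟨ +ˢ-congˡ (numᵗ (suc (suc m)) *ˢ W) (-ˢ-cong (*ˢ-congˡ (denᵗ (suc (suc m))) Y-fixed)) ⟩
    numᵗ (suc (suc m)) *ˢ W -ˢ denᵗ (suc (suc m)) *ˢ ([n] *ˢ W +ˢ qPS^ n *ˢ (qPS^ n *ˢ Y))
      ≈⟨ solve 6 (λ q X N Y r p →
             (N :* (q :* (N :* r) :+ p) :+ (q :* X) :* ((q :* X) :* r)) :* (con (+ 1) :+ q :* (N :* Y))
             :- (q :* (N :* r) :+ p) :* (N :* (con (+ 1) :+ q :* (N :* Y)) :+ (q :* X) :* ((q :* X) :* Y))
           := q :* (q :* (X :* X :* (r :- p :* Y))))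
           (λ _ → refl) qPS (qPS^ k) [n] Y (numᵗ m) (denᵗ m) ⟩
    qPS *ˢ (qPS *ˢ (qPS^ k *ˢ qPS^ k *ˢ error m)) ∎
    where open ≗-Reasoning

  error-order : ∀ m → error m ≡ 0ˢ mod-q^ m
  error-order zero          = λ _ ()
  error-order (suc zero)    = mod-cancel-unit W refl (mod-extend (λ _ ()) (error-one 0))
  error-order (suc (suc m)) = mod-cancel-unit W refl λ i i<2+m →
    trans (error-step m i) (qPS*-order (qPS*-order (*ˢ-order (qPS^ k *ˢ qPS^ k) (error-order m))) i i<2+m)

  denᵗ*Y≡numᵗ : ∀ m → denᵗ m *ˢ Y ≡ numᵗ m mod-q^ m
  denᵗ*Y≡numᵗ m i i<m = sym (ℤP.i-j≡0⇒i≡j _ _ (error-order m i i<m))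

proposition2p5 : (n : ℕ) → 1 ≤ n →
    Σ PS (λ S → IsQDeformation (λ _ → + n) S × QuadEq n S
                × (∀ T → QuadEq n T → ∀ j → T j ≡ S j))
proposition2p5 (suc k) _ =
  Y , isQDeformation ,
  (λ j → trans (sym (quadratic≗psMul Y j)) (solution-solves j)) ,
  (λ T T-solves → solution-unique T λ j → trans (quadratic≗psMul T j) (T-solves j))
  where
  open Convergence k
  isQDeformation : IsQDeformation (λ _ → + n) Y
  isQDeformation j = suc j , λ m j<m →
    agreesUpTo-represents (cfTailᵗ-represents 0 m) (denᵗ-constant m)
                          (mod-weaken j<m (denᵗ*Y≡numᵗ m))
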